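{- Let $m\ge2$ and let $\mathcal{T}$ be an $m$-uniform hypertree with a perfect matching and with more than one edge. Then there is a vertex $u$ such that $\mathcal{T}=\mathcal{T}'(u)\odot Comb_u(u)$, where $Comb_u$ is an $m$-comb with endpoint $u$ and $\mathcal{T}'$ is a sub-hypertree of $\mathcal{T}$ having a perfect matching. Consequently, $\mathcal{T}$ has a unique perfect matching.
   Context: Hypergraphs are simple, $m$-uniform; a hypertree is a connected hypergraph without cycles. A perfect matching is a set of pairwise disjoint edges covering all vertices. An $m$-comb with endpoint $u$: an edge $e_0=\{u,v_1,\dots,v_{m-1}\}$ together with $m-1$ further pairwise disjoint edges $e_1,\dots,e_{m-1}$, where $e_i$ meets $e_0$ exactly in $v_i$. $\mathcal{T}'(u)\odot Comb_u(u)$ denotes the hypergraph obtained from $\mathcal{T}'$ and $Comb_u$ (otherwise disjoint) by identifying the vertex $u$ of $\mathcal{T}'$ with the endpoint $u$ of the comb. -}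

module Defs where

open import Data.Nat using (ℕ; zero; suc; _≤_; _∸_)
open import Data.Fin using (Fin; zero; suc; inject₁; fromℕ)
open import Data.Fin.Subset using (Subset; _∈_; _∉_; _⊆_; ∣_∣; ⊤)
open import Data.Product using (Σ; ∃; ∃-syntax; _×_; _,_)
open import Data.Sum using (_⊎_)
open import Data.Empty using (⊥)
open import Relation.Nullary using (¬_)
open import Relation.Binary.PropositionalEquality using (_≡_; _≢_)
open import Function.Definitions using (Injective)
open import Function.Bundles using (_⇔_)

-- Convention: a hypergraph on the ambient vertex type Fin n is given by
-- a vertex set V : Subset n, a family of (candidate) edges E : Fin k → Subset n,
-- and a set S : Subset k of indices of the edges actually present.
-- The whole hypertree T is (⊤, E, ⊤); sub-hypergraphs keep the same E.

module _ {n k : ℕ} (E : Fin k → Subset n) where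

  Disjoint : Subset n → Subset n → Set
  Disjoint A B = ∀ x → x ∈ A → x ∈ B → ⊥

  IsHypergraph : Subset n → Subset k → Set
  IsHypergraph V S = ∀ i → i ∈ S → E i ⊆ V

  data Reach (S : Subset k) : Fin n → Fin n → Set where
    here : ∀ {x} → Reach S x x
    step : ∀ {x z y} (i : Fin k) → i ∈ S → x ∈ E i → z ∈ E i →
           Reach S z y → Reach S x y

  Connected : Subset n → Subset k → Set
  Connected V S = ∀ x y → x ∈ V → y ∈ V → Reach S x y

  -- A (Berge) cycle of length L ≥ 2 with edges from S:
  -- distinct vertices v₀,…,v_{L-1} (v_L = v₀) and distinct edges f₀,…,f_{L-1}
  -- with v_j , v_{j+1} ∈ f_j.
  record Cycle (S : Subset k) : Set where
    field
      L      : ℕ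
      L≥2    : 2 ≤ L
      v      : Fin (suc L) → Fin n
      f      : Fin L → Fin k
      closed : v (fromℕ L) ≡ v zero
      v-inj  : Injective _≡_ _≡_ (λ j → v (inject₁ j))
      f-inj  : Injective _≡_ _≡_ f
      f∈S    : ∀ j → f j ∈ S
      left   : ∀ j → v (inject₁ j) ∈ E (f j)
      right  : ∀ j → v (suc j) ∈ E (f j)

  Acyclic : Subset k → Set
  Acyclic S = ¬ Cycle S

  IsHypertree : Subset n → Subset k → Set
  IsHypertree V S = IsHypergraph V S × Connected V S × Acyclic S

  IsPerfectMatching : Subset n → Subset k → Subset k → Set
  IsPerfectMatching V S M =
    M ⊆ S ×
    (∀ i j → i ∈ M → j ∈ M → i ≢ j → Disjoint (E i) (E j)) ×
    (∀ x → x ∈ V → ∃[ i ] (i ∈ M × x ∈ E i))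

  HasPerfectMatching : Subset n → Subset k → Set
  HasPerfectMatching V S = ∃[ M ] IsPerfectMatching V S M

  IsUniformHypertree : ℕ → Set
  IsUniformHypertree m =
    Injective _≡_ _≡_ E × (∀ i → ∣ E i ∣ ≡ m) × IsHypertree ⊤ ⊤

  record Comb (m : ℕ) (u : Fin n) : Set where
    field
      e₀      : Fin k
      vs      : Fin (m ∸ 1) → Fin n
      es      : Fin (m ∸ 1) → Fin k
      vs-inj  : Injective _≡_ _≡_ vs
      u≢vs    : ∀ i → u ≢ vs i
      e₀-def  : ∀ x → (x ∈ E e₀) ⇔ (x ≡ u ⊎ ∃[ i ] x ≡ vs i)
      es-inj  : Injective _≡_ _≡_ es
      es≢e₀   : ∀ i → es i ≢ e₀
      es-meet : ∀ i x → (x ∈ E (es i) × x ∈ E e₀) ⇔ (x ≡ vs i)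
      es-disj : ∀ i j → i ≢ j → Disjoint (E (es i)) (E (es j))

  module _ {m : ℕ} {u : Fin n} (C : Comb m u) where
    open Comb C

    InCombV : Fin n → Set
    InCombV x = x ∈ E e₀ ⊎ ∃[ i ] x ∈ E (es i)

    InCombE : Fin k → Set
    InCombE j = j ≡ e₀ ⊎ ∃[ i ] j ≡ es i

    -- T = T'(u) ⊙ Comb_u(u) where T' = (V' , S'):
    -- edges of T split into those of T' and those of the comb,
    -- vertices of T are those of T' and of the comb, sharing exactly u.
    IsGlued : Subset n → Subset k → Set
    IsGlued V' S' =
      (∀ j → (j ∈ S') ⇔ (¬ InCombE j)) ×
      (∀ x → x ∈ V' ⊎ InCombV x) ×
      (∀ x → (x ∈ V' × InCombV x) ⇔ (x ≡ u))

{-# OPTIONS --safe #-}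
-- Walk through the hypertree: having entered an edge e at a vertex u, move on to an edge h
-- attached to e at some vertex y ≠ u, as long as h itself has further edges attached to it away
-- from y. Acyclicity keeps the walk a simple path, so it stops at an edge e₀ (the spine) entered
-- at u such that every edge attached to e₀ away from u is pendant: its vertices other than the
-- attachment point lie in no other edge. Such a pendant edge belongs to every perfect matching,
-- being the only edge that covers those vertices; hence e₀ belongs to none, and each vertex of e₀
-- other than u is covered by exactly one pendant edge. These are the teeth of the comb. Deleting
-- the comb except for u leaves a hypertree to which every perfect matching restricts, and
-- induction on the number of edges yields uniqueness.
module Submission where

open import Defs

open import Data.Fin using (Fin; zero; suc; toℕ; inject₁; inject≤; fromℕ; punchIn; punchOut)
open import Data.Fin.Properties
  using (suc-injective; toℕ-injective; toℕ-inject≤; toℕ-inject₁; toℕ-fromℕ; toℕ<n; toℕ≤pred[n];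
         inject≤-injective; punchIn-injective; punchInᵢ≢i; punchIn-punchOut; injective⇒≤; any?; _≟_)
open import Data.Fin.Subset using (Subset; _∈_; _∉_; _⊆_; _⊂_; _∩_; ⊤; inside; outside; ∣_∣)
open import Data.Fin.Subset.Properties using (_∈?_; x∈p∩q⁺; x∈p∩q⁻; ∈⊤; ⊆-antisym; p⊂q⇒∣p∣<∣q∣)
open import Data.Nat using (ℕ; zero; suc; _+_; _≤_; _<_; z≤n; s≤s; s≤s⁻¹)
open import Data.Nat.Properties using (<-irrefl; <-≤-trans; n<1+n; +-identityʳ; +-suc)
open import Data.Product using (Σ; ∃₂; ∃-syntax; _×_; _,_; proj₁; proj₂)
open import Data.Sum using (_⊎_; inj₁; inj₂)
import Data.Vec.Base as Vec
open import Data.Vec.Base using (here; there)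
open import Data.Vec.Functional using (Vector; _∷_)
open import Data.Vec.Properties using (lookup∘tabulate; lookup⇒[]=; []=⇒lookup)
open import Function using (_∘_)
open import Function.Bundles using (_⇔_; mk⇔; Equivalence)
open import Function.Definitions using (Injective)
open import Level using (Level)
open import Relation.Binary.PropositionalEquality
open import Relation.Nullary using (¬_; Dec; yes; no; does; proof; contradiction)
open import Relation.Nullary.Decidable using (dec-true; _×-dec_; _⊎-dec_; ¬?)
open import Relation.Nullary.Reflects using (Reflects; invert)
open import Relation.Unary using (Pred; Decidable)

private
  variable
    a b : Level
    A : Set a
    m n c : ℕ

∷-injective : {x : A} {xs : Vector A m} →
              Injective _≡_ _≡_ xs → (∀ i → xs i ≢ x) → Injective _≡_ _≡_ (x ∷ xs)
∷-injective inj fresh {zero}  {zero}  eq = refl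
∷-injective inj fresh {zero}  {suc j} eq = contradiction (sym eq) (fresh j)
∷-injective inj fresh {suc i} {zero}  eq = contradiction eq (fresh i)
∷-injective inj fresh {suc i} {suc j} eq = cong suc (inj eq)

snoc : Vector A m → A → Vector A (suc m)
snoc {m = zero}  xs x zero    = x
snoc {m = suc m} xs x zero    = xs zero
snoc {m = suc m} xs x (suc i) = snoc (xs ∘ suc) x i

snoc-inject₁ : (xs : Vector A m) (x : A) (i : Fin m) → snoc xs x (inject₁ i) ≡ xs i
snoc-inject₁ {m = suc m} xs x zero    = refl
snoc-inject₁ {m = suc m} xs x (suc i) = snoc-inject₁ (xs ∘ suc) x i

snoc-fromℕ : (xs : Vector A m) (x : A) → snoc xs x (fromℕ m) ≡ x
snoc-fromℕ {m = zero}  xs x = refl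
snoc-fromℕ {m = suc m} xs x = snoc-fromℕ (xs ∘ suc) x

data InitLast : ∀ {m} → Fin (suc m) → Set where
  init : ∀ {m} (i : Fin m) → InitLast (inject₁ i)
  last : ∀ {m} → InitLast (fromℕ m)

initLast : (i : Fin (suc m)) → InitLast i
initLast {m = zero}  zero    = last
initLast {m = suc m} zero    = init zero
initLast {m = suc m} (suc i) with initLast i
... | init j = init (suc j)
... | last   = last

snoc-injective : {x : A} {xs : Vector A m} →
                 Injective _≡_ _≡_ xs → (∀ i → xs i ≢ x) → Injective _≡_ _≡_ (snoc xs x)
snoc-injective {x = x} {xs} inj fresh {i} {j} eq with initLast i | initLast j
... | init i′ | init j′ = cong inject₁ (inj (begin
  xs i′                  ≡⟨ snoc-inject₁ xs x i′ ⟨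
  snoc xs x (inject₁ i′) ≡⟨ eq ⟩
  snoc xs x (inject₁ j′) ≡⟨ snoc-inject₁ xs x j′ ⟩
  xs j′                  ∎))
  where open ≡-Reasoning
... | init i′ | last    =
  contradiction (trans (sym (snoc-inject₁ xs x i′)) (trans eq (snoc-fromℕ xs x))) (fresh i′)
... | last    | init j′ =
  contradiction (trans (sym (snoc-inject₁ xs x j′)) (trans (sym eq) (snoc-fromℕ xs x))) (fresh j′)
... | last    | last    = refl

inject≤-inject₁ : ∀ (i : Fin m) .(p : suc m ≤ suc n) .(q : m ≤ n) →
                  inject≤ (inject₁ i) p ≡ inject₁ (inject≤ i q)
inject≤-inject₁ i p q = toℕ-injective (begin
  toℕ (inject≤ (inject₁ i) p) ≡⟨ toℕ-inject≤ (inject₁ i) p ⟩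
  toℕ (inject₁ i)             ≡⟨ toℕ-inject₁ i ⟩
  toℕ i                       ≡⟨ toℕ-inject≤ i q ⟨
  toℕ (inject≤ i q)           ≡⟨ toℕ-inject₁ (inject≤ i q) ⟨
  toℕ (inject₁ (inject≤ i q)) ∎)
  where open ≡-Reasoning

record Enumeration (p : Subset n) (c : ℕ) : Set where
  field
    at           : Fin c → Fin n
    at-injective : Injective _≡_ _≡_ at
    at∈p         : ∀ i → at i ∈ p
    at-onto      : ∀ {x} → x ∈ p → ∃[ i ] at i ≡ x

enumerate : (p : Subset n) → Enumeration p ∣ p ∣
enumerate Vec.[] = record
  { at = λ () ; at-injective = λ { {()} } ; at∈p = λ () ; at-onto = λ () }
enumerate (outside Vec.∷ p) = record
  { at           = suc ∘ at
  ; at-injective = at-injective ∘ suc-injective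
  ; at∈p         = there ∘ at∈p
  ; at-onto      = λ { (there x∈p) → let (i , eq) = at-onto x∈p in i , cong suc eq }
  }
  where open Enumeration (enumerate p)
enumerate (inside Vec.∷ p) = record
  { at           = zero ∷ suc ∘ at
  ; at-injective = ∷-injective (at-injective ∘ suc-injective) (λ i ())
  ; at∈p         = λ { zero → here ; (suc i) → there (at∈p i) }
  ; at-onto      = λ { here → zero , refl
                     ; (there x∈p) → let (i , eq) = at-onto x∈p in suc i , cong suc eq }
  }
  where open Enumeration (enumerate p)

record Punctured (p : Subset n) (x : Fin n) (c : ℕ) : Set where
  field
    others           : Fin c → Fin n
    others-injective : Injective _≡_ _≡_ others
    others≢x         : ∀ i → others i ≢ x
    ∈⇔≡⊎others       : ∀ y → y ∈ p ⇔ (y ≡ x ⊎ ∃[ i ] y ≡ others i)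

puncture : {p : Subset n} {x : Fin n} → Enumeration p (suc c) → x ∈ p → Punctured p x c
puncture {c = c} {p = p} {x} enum x∈p = record
  { others           = at ∘ punchIn pos
  ; others-injective = punchIn-injective pos _ _ ∘ at-injective
  ; others≢x         = λ i eq → punchInᵢ≢i pos i (at-injective (trans eq (sym at-pos)))
  ; ∈⇔≡⊎others       = λ y → mk⇔ (split y) join
  }
  where
  open Enumeration enum
  pos : Fin (suc c)
  pos = proj₁ (at-onto x∈p)
  at-pos : at pos ≡ x
  at-pos = proj₂ (at-onto x∈p)
  split : ∀ y → y ∈ p → y ≡ x ⊎ ∃[ i ] y ≡ at (punchIn pos i)
  split y y∈p with at-onto y∈p
  ... | j , refl with pos ≟ j
  ...   | yes refl = inj₁ at-pos
  ...   | no pos≢j = inj₂ (punchOut pos≢j , cong at (sym (punchIn-punchOut pos≢j)))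
  join : ∀ {y} → y ≡ x ⊎ ∃[ i ] y ≡ at (punchIn pos i) → y ∈ p
  join (inj₁ refl)       = x∈p
  join (inj₂ (i , refl)) = at∈p (punchIn pos i)

module _ {P : Pred (Fin n) b} (P? : Decidable P) where

  toSubset : Subset n
  toSubset = Vec.tabulate (does ∘ P?)

  ∈-toSubset⁺ : ∀ {x} → P x → x ∈ toSubset
  ∈-toSubset⁺ {x} px = lookup⇒[]= x toSubset (trans (lookup∘tabulate _ x) (dec-true (P? x) px))

  ∈-toSubset⁻ : ∀ {x} → x ∈ toSubset → P x
  ∈-toSubset⁻ {x} x∈ =
    invert (subst (Reflects (P x)) (trans (sym (lookup∘tabulate _ x)) ([]=⇒lookup x∈)) (proof (P? x)))

Acyclic-mono : ∀ {k} {E : Fin k → Subset n} {S S′ : Subset k} →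
               S′ ⊆ S → Acyclic E S → Acyclic E S′
Acyclic-mono S′⊆S acyclic cycle = acyclic (record
  { L = L ; L≥2 = L≥2 ; v = v ; f = f ; closed = closed ; v-inj = v-inj ; f-inj = f-inj
  ; f∈S = S′⊆S ∘ f∈S ; left = left ; right = right })
  where open Cycle cycle

module _ {k : ℕ} (E : Fin k → Subset n) (S : Subset k) where

  -- Paths grow at index zero; as in Cycle, f j joins v (inject₁ j) and v (suc j).
  record SimplePath (ℓ : ℕ) : Set where
    field
      v     : Fin (suc ℓ) → Fin n
      f     : Fin ℓ → Fin k
      v-inj : Injective _≡_ _≡_ v
      f-inj : Injective _≡_ _≡_ f
      f∈S   : ∀ j → f j ∈ S
      left  : ∀ j → v (inject₁ j) ∈ E (f j)
      right : ∀ j → v (suc j) ∈ E (f j)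

  open SimplePath

  trivialPath : Fin n → SimplePath 0
  trivialPath x = record
    { v = λ _ → x ; f = λ () ; v-inj = λ { {zero} {zero} _ → refl }
    ; f-inj = λ { {()} } ; f∈S = λ () ; left = λ () ; right = λ () }

  extend : ∀ {ℓ} (P : SimplePath ℓ) {g : Fin k} {z : Fin n} →
           g ∈ S → z ∈ E g → v P zero ∈ E g → (∀ i → v P i ≢ z) → (∀ j → f P j ≢ g) →
           SimplePath (suc ℓ)
  extend P {g} {z} g∈S z∈g head∈g z-fresh g-fresh = record
    { v     = z ∷ v P
    ; f     = g ∷ f P
    ; v-inj = ∷-injective (v-inj P) z-fresh
    ; f-inj = ∷-injective (f-inj P) g-fresh
    ; f∈S   = λ { zero → g∈S ; (suc j) → f∈S P j }
    ; left  = λ { zero → z∈g ; (suc j) → left P j }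
    ; right = λ { zero → head∈g ; (suc j) → right P j }
    }

  prefix : ∀ {ℓ} (P : SimplePath ℓ) (i : Fin (suc ℓ)) → SimplePath (toℕ i)
  prefix {ℓ} P i = record
    { v     = λ j → v P (inject≤ j i<1+ℓ)
    ; f     = λ j → f P (inject≤ j i≤ℓ)
    ; v-inj = inject≤-injective _ _ _ _ ∘ v-inj P
    ; f-inj = inject≤-injective _ _ _ _ ∘ f-inj P
    ; f∈S   = λ j → f∈S P _
    ; left  = λ j → subst (λ t → v P t ∈ E (f P (inject≤ j i≤ℓ)))
                          (sym (inject≤-inject₁ j i<1+ℓ i≤ℓ)) (left P _)
    ; right = λ j → right P _
    }
    where
    i≤ℓ : toℕ i ≤ ℓ
    i≤ℓ = toℕ≤pred[n] i
    i<1+ℓ : suc (toℕ i) ≤ suc ℓ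
    i<1+ℓ = s≤s i≤ℓ

  prefix-last : ∀ {ℓ} (P : SimplePath ℓ) (i : Fin (suc ℓ)) → v (prefix P i) (fromℕ (toℕ i)) ≡ v P i
  prefix-last P i =
    cong (v P) (toℕ-injective (trans (toℕ-inject≤ (fromℕ (toℕ i)) _) (toℕ-fromℕ (toℕ i))))

  closeCycle : ∀ {ℓ} (P : SimplePath (suc ℓ)) {g : Fin k} → g ∈ S → (∀ j → f P j ≢ g) →
               v P (fromℕ (suc ℓ)) ∈ E g → v P zero ∈ E g → Cycle E S
  closeCycle {ℓ} P {g} g∈S g-fresh last∈g head∈g = record
    { L      = suc (suc ℓ)
    ; L≥2    = s≤s (s≤s z≤n)
    ; v      = v′
    ; f      = f′
    ; closed = snoc-fromℕ (v P) (v P zero)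
    ; v-inj  = λ {i} {j} eq →
                 v-inj P (trans (sym (snoc-inject₁ (v P) _ i)) (trans eq (snoc-inject₁ (v P) _ j)))
    ; f-inj  = snoc-injective (f-inj P) g-fresh
    ; f∈S    = f′∈S
    ; left   = left′
    ; right  = right′
    }
    where
    v′ : Fin (suc (suc (suc ℓ))) → Fin n
    v′ = snoc (v P) (v P zero)
    f′ : Fin (suc (suc ℓ)) → Fin k
    f′ = snoc (f P) g
    ∈-resp : ∀ {x x′ e e′} → x ≡ x′ → e ≡ e′ → x′ ∈ E e′ → x ∈ E e
    ∈-resp refl refl x∈e = x∈e
    f′∈S : ∀ j → f′ j ∈ S
    f′∈S j with initLast j
    ... | init i = subst (_∈ S) (sym (snoc-inject₁ (f P) g i)) (f∈S P i)
    ... | last   = subst (_∈ S) (sym (snoc-fromℕ (f P) g)) g∈S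
    left′ : ∀ j → v′ (inject₁ j) ∈ E (f′ j)
    left′ j with initLast j
    ... | init i = ∈-resp (snoc-inject₁ (v P) _ (inject₁ i)) (snoc-inject₁ (f P) g i) (left P i)
    ... | last   = ∈-resp (snoc-inject₁ (v P) _ (fromℕ _)) (snoc-fromℕ (f P) g) last∈g
    right′ : ∀ j → v′ (suc j) ∈ E (f′ j)
    right′ j with initLast j
    ... | init i = ∈-resp (snoc-inject₁ (v P) _ (suc i)) (snoc-inject₁ (f P) g i) (right P i)
    ... | last   = ∈-resp (snoc-fromℕ (v P) _) (snoc-fromℕ (f P) g) head∈g

  chordCycle : ∀ {ℓ} (P : SimplePath ℓ) {e : Fin k} →
               e ∈ S → (∀ j → f P j ≢ e) → v P zero ∈ E e → ∀ i → v P (suc i) ∈ E e → Cycle E S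
  chordCycle P e∈S e-fresh head∈e i vi∈e =
    closeCycle (prefix P (suc i)) e∈S (λ _ → e-fresh _)
      (subst (_∈ E _) (sym (prefix-last P (suc i))) vi∈e) head∈e

  reentryCycle : ∀ {ℓ} (P : SimplePath ℓ) {e : Fin k} {y : Fin n} →
                 e ∈ S → (∀ j → f P j ≢ e) → v P zero ∈ E e → y ∈ E e → (∀ i → v P i ≢ y) →
                 ∀ j → y ∈ E (f P j) → Cycle E S
  reentryCycle P e∈S e-fresh head∈e y∈e y-fresh j y∈fj =
    closeCycle Q (f∈S P j) Q-avoids-fj
      (subst (_∈ E (f P j)) (sym (prefix-last P (inject₁ j))) (left P j)) y∈fj
    where
    Q : SimplePath (suc (toℕ (inject₁ j)))
    Q = extend (prefix P (inject₁ j)) e∈S y∈e head∈e (λ _ → y-fresh _) (λ _ → e-fresh _)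
    Q-avoids-fj : ∀ i → f Q i ≢ f P j
    Q-avoids-fj zero    eq = e-fresh j (sym eq)
    Q-avoids-fj (suc i) eq = <-irrefl (trans (sym (toℕ-inject≤ i _)) (cong toℕ (f-inj P eq)))
                                      (subst (toℕ i <_) (toℕ-inject₁ j) (toℕ<n i))

  Attached : Fin n → Fin k → Fin n → Fin k → Set
  Attached u e y h = y ∈ E e × y ≢ u × h ∈ S × y ∈ E h × h ≢ e

  Branch : Fin n → Fin k → Set
  Branch u e = ∃₂ (Attached u e)

  Pendant : Fin n → Fin k → Set
  Pendant y h = ∀ z → z ∈ E h → z ≢ y → ∀ h′ → h′ ∈ S → z ∈ E h′ → h′ ≡ h

  attached? : ∀ u e y h → Dec (Attached u e y h)
  attached? u e y h = y ∈? E e ×-dec ¬? (y ≟ u) ×-dec h ∈? S ×-dec y ∈? E h ×-dec ¬? (h ≟ e)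

  branch? : ∀ u e → Dec (Branch u e)
  branch? u e = any? λ y → any? λ h → attached? u e y h

  Continuation : Fin n → Fin k → Set
  Continuation u e = ∃₂ λ y h → Attached u e y h × Branch y h

  continuation? : ∀ u e → Dec (Continuation u e)
  continuation? u e = any? λ y → any? λ h → attached? u e y h ×-dec branch? y h

  ¬branch⇒pendant : ∀ {y h} → ¬ Branch y h → Pendant y h
  ¬branch⇒pendant {y} {h} ¬branch z z∈h z≢y h′ h′∈S z∈h′ with h′ ≟ h
  ... | yes h′≡h = h′≡h
  ... | no  h′≢h = contradiction (z , h′ , z∈h , z≢y , h′∈S , z∈h′ , h′≢h) ¬branch

  -- root and spine are the endpoint u and the edge e₀ of the comb to be built.
  record Spine : Set where
    field
      root     : Fin n
      spine    : Fin k
      spine∈S  : spine ∈ S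
      root∈    : root ∈ E spine
      pendant  : ∀ {y h} → Attached root spine y h → Pendant y h
      branches : Branch root spine

  adjacentEdges : ∀ {x w e h} → Reach E S x w → e ∈ S → x ∈ E e → h ∈ S → w ∈ E h → e ≢ h →
                  ∃₂ λ e′ y → e′ ∈ S × y ∈ E e′ × ∃[ h′ ] (h′ ∈ S × y ∈ E h′ × h′ ≢ e′)
  adjacentEdges {x} here e∈S x∈e h∈S x∈h e≢h = _ , x , e∈S , x∈e , _ , h∈S , x∈h , e≢h ∘ sym
  adjacentEdges {x} {e = e} (step i i∈S x∈i z∈i rest) e∈S x∈e h∈S w∈h e≢h with i ≟ e
  ... | yes refl = adjacentEdges rest i∈S z∈i h∈S w∈h e≢h
  ... | no  i≢e  = e , x , e∈S , x∈e , i , i∈S , x∈i , i≢e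

  matchingEdge-unique : ∀ {V M} → IsPerfectMatching E V S M → ∀ {x i j} →
                        i ∈ M → j ∈ M → x ∈ E i → x ∈ E j → i ≡ j
  matchingEdge-unique (_ , disjoint , _) {x} {i} {j} i∈M j∈M x∈i x∈j with i ≟ j
  ... | yes i≡j = i≡j
  ... | no  i≢j = contradiction x∈j (disjoint i j i∈M j∈M i≢j x x∈i)

  module _ (acyclic : Acyclic E S) where

    path-avoids-vertex : ∀ {ℓ} (P : SimplePath ℓ) {e : Fin k} {y : Fin n} →
                         e ∈ S → (∀ j → f P j ≢ e) → v P zero ∈ E e → y ∈ E e → y ≢ v P zero →
                         ∀ i → v P i ≢ y
    path-avoids-vertex P e∈S e-fresh head∈e y∈e y≢head zero    eq   = y≢head (sym eq)
    path-avoids-vertex P e∈S e-fresh head∈e y∈e y≢head (suc i) refl =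
      acyclic (chordCycle P e∈S e-fresh head∈e i y∈e)

    path-avoids-edge : ∀ {ℓ} (P : SimplePath ℓ) {e h : Fin k} {y : Fin n} →
                       e ∈ S → (∀ j → f P j ≢ e) → v P zero ∈ E e → y ∈ E e → (∀ i → v P i ≢ y) →
                       y ∈ E h → ∀ j → f P j ≢ h
    path-avoids-edge P e∈S e-fresh head∈e y∈e y-fresh y∈h j refl =
      acyclic (reentryCycle P e∈S e-fresh head∈e y∈e y-fresh j y∈h)

    -- The edges of P together with e are distinct, so ℓ < k and r bounds the remaining steps.
    walk : ∀ r {ℓ} (P : SimplePath ℓ) {e : Fin k} → ℓ + r ≡ k → e ∈ S → v P zero ∈ E e →
           (∀ j → f P j ≢ e) → Branch (v P zero) e → Spine
    walk zero {ℓ} P ℓ≡k _ _ e-fresh _ =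
      contradiction (injective⇒≤ (∷-injective (f-inj P) e-fresh))
                    (<-irrefl (trans (sym (+-identityʳ ℓ)) ℓ≡k))
    walk (suc r) {ℓ} P {e} ℓ+r≡k e∈S head∈e e-fresh branches
      with continuation? (v P zero) e
    ... | no ¬continuation = record
      { root = v P zero ; spine = e ; spine∈S = e∈S ; root∈ = head∈e ; branches = branches
      ; pendant = λ {y} {h} att → ¬branch⇒pendant (λ br → ¬continuation (y , h , att , br)) }
    ... | yes (y , h , (y∈e , y≢head , h∈S , y∈h , h≢e) , branches′) =
      walk r P′ (trans (sym (+-suc ℓ r)) ℓ+r≡k) h∈S y∈h h-fresh branches′
      where
      y-fresh : ∀ i → v P i ≢ y
      y-fresh = path-avoids-vertex P e∈S e-fresh head∈e y∈e y≢head
      P′ : SimplePath (suc ℓ)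
      P′ = extend P e∈S y∈e head∈e y-fresh e-fresh
      h-fresh : ∀ j → f P′ j ≢ h
      h-fresh zero    = h≢e ∘ sym
      h-fresh (suc j) = path-avoids-edge P e∈S e-fresh head∈e y∈e y-fresh y∈h j

module Uniform {k : ℕ} (E : Fin k → Subset n) (p : ℕ) (card : ∀ i → ∣ E i ∣ ≡ suc (suc p)) where

  enumeration : ∀ i → Enumeration (E i) (suc (suc p))
  enumeration i = subst (Enumeration (E i)) (card i) (enumerate (E i))

  punctured : ∀ {i y} → y ∈ E i → Punctured (E i) y (suc p)
  punctured = puncture (enumeration _)

  someVertex : ∀ i → ∃[ x ] x ∈ E i
  someVertex i = at zero , at∈p zero
    where open Enumeration (enumeration i)

  anotherVertex : ∀ {i y} → y ∈ E i → ∃[ z ] z ∈ E i × z ≢ y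
  anotherVertex {y = y} y∈i =
    others zero , Equivalence.from (∈⇔≡⊎others (others zero)) (inj₂ (zero , refl)) , others≢x zero
    where open Punctured (punctured y∈i)

  module _ {V : Subset n} {S : Subset k} where

    pendant⇒matched : IsHypergraph E V S → ∀ {N} → IsPerfectMatching E V S N →
                      ∀ {y h} → h ∈ S → y ∈ E h → Pendant E S y h → h ∈ N
    pendant⇒matched hypergraph {N} (N⊆S , _ , covers) h∈S y∈h pendant =
      let (z , z∈h , z≢y)   = anotherVertex y∈h
          (j , j∈N , z∈j)   = covers z (hypergraph _ h∈S z∈h)
      in subst (_∈ N) (pendant z z∈h z≢y j (N⊆S j∈N) z∈j) j∈N

    spineOf : IsHypertree E V S → ∀ {e h} → e ∈ S → h ∈ S → e ≢ h → Spine E S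
    spineOf (hypergraph , connected , acyclic) {e} {h} e∈S h∈S e≢h =
      let (x , x∈e) = someVertex e
          (w , w∈h) = someVertex h
          (e′ , y , e′∈S , y∈e′ , h′ , h′∈S , y∈h′ , h′≢e′) =
            adjacentEdges E S (connected x w (hypergraph e e∈S x∈e) (hypergraph h h∈S w∈h))
                          e∈S x∈e h∈S w∈h e≢h
          (u , u∈e′ , u≢y) = anotherVertex y∈e′
      in walk E S acyclic k (trivialPath E S u) refl e′∈S u∈e′ (λ ())
              (y , h′ , y∈e′ , u≢y ∘ sym , h′∈S , y∈h′ , h′≢e′)

    module Decomposition (hypertree : IsHypertree E V S) (sp : Spine E S)
                         {M : Subset k} (matching : IsPerfectMatching E V S M) where

      open Spine sp
      open Punctured (punctured root∈)
        renaming (others to joint; others-injective to joint-injective; others≢x to joint≢root)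

      private
        hypergraph : IsHypergraph E V S
        hypergraph = proj₁ hypertree
        acyclic : Acyclic E S
        acyclic = proj₂ (proj₂ hypertree)

      spine∉matching : ∀ {N} → IsPerfectMatching E V S N → spine ∉ N
      spine∉matching N-matching spine∈N =
        let (y , h , attached@(y∈spine , _ , h∈S , y∈h , h≢spine)) = branches
            h∈N = pendant⇒matched hypergraph N-matching h∈S y∈h (pendant attached)
        in h≢spine (matchingEdge-unique E S N-matching h∈N spine∈N y∈h y∈spine)

      joint∈spine : ∀ i → joint i ∈ E spine
      joint∈spine i = Equivalence.from (∈⇔≡⊎others (joint i)) (inj₂ (i , refl))

      private
        cover : ∀ i → ∃[ j ] (j ∈ M × joint i ∈ E j)
        cover i = proj₂ (proj₂ matching) (joint i) (hypergraph _ spine∈S (joint∈spine i))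

      tooth : Fin (suc p) → Fin k
      tooth i = proj₁ (cover i)

      tooth∈M : ∀ i → tooth i ∈ M
      tooth∈M i = proj₁ (proj₂ (cover i))

      joint∈tooth : ∀ i → joint i ∈ E (tooth i)
      joint∈tooth i = proj₂ (proj₂ (cover i))

      tooth∈S : ∀ i → tooth i ∈ S
      tooth∈S i = proj₁ matching (tooth∈M i)

      tooth≢spine : ∀ i → tooth i ≢ spine
      tooth≢spine i eq = spine∉matching matching (subst (_∈ M) eq (tooth∈M i))

      tooth-pendant : ∀ i → Pendant E S (joint i) (tooth i)
      tooth-pendant i =
        pendant (joint∈spine i , joint≢root i , tooth∈S i , joint∈tooth i , tooth≢spine i)

      attached⇒tooth : ∀ i {h} → h ∈ S → joint i ∈ E h → h ≢ spine → h ≡ tooth i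
      attached⇒tooth i h∈S joint∈h h≢spine =
        matchingEdge-unique E S matching (pendant⇒matched hypergraph matching h∈S joint∈h h-pendant)
                            (tooth∈M i) joint∈h (joint∈tooth i)
        where
        h-pendant : Pendant E S (joint i) _
        h-pendant = pendant (joint∈spine i , joint≢root i , h∈S , joint∈h , h≢spine)

      tooth∩spine : ∀ i {x} → x ∈ E (tooth i) → x ∈ E spine → x ≡ joint i
      tooth∩spine i {x} x∈tooth x∈spine with x ≟ joint i
      ... | yes x≡joint = x≡joint
      ... | no  x≢joint =
        contradiction (sym (tooth-pendant i x x∈tooth x≢joint spine spine∈S x∈spine)) (tooth≢spine i)

      tooth-injective : Injective _≡_ _≡_ tooth
      tooth-injective {i} {j} eq = sym (joint-injective (tooth∩spine i joint∈tooth′ (joint∈spine j)))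
        where
        joint∈tooth′ : joint j ∈ E (tooth i)
        joint∈tooth′ = subst (λ t → joint j ∈ E t) (sym eq) (joint∈tooth j)

      comb : Comb E (suc (suc p)) root
      comb = record
        { e₀      = spine
        ; vs      = joint
        ; es      = tooth
        ; vs-inj  = joint-injective
        ; u≢vs    = λ i → joint≢root i ∘ sym
        ; e₀-def  = ∈⇔≡⊎others
        ; es-inj  = tooth-injective
        ; es≢e₀   = tooth≢spine
        ; es-meet = λ i x → mk⇔ (λ (x∈tooth , x∈spine) → tooth∩spine i x∈tooth x∈spine)
                                 (λ { refl → joint∈tooth i , joint∈spine i })
        ; es-disj = λ i j i≢j → proj₁ (proj₂ matching) (tooth i) (tooth j) (tooth∈M i) (tooth∈M j)
                                                        (i≢j ∘ tooth-injective)
        }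

      CombVertex : Fin n → Set
      CombVertex = InCombV E comb

      CombEdge : Fin k → Set
      CombEdge = InCombE E comb

      combVertex? : ∀ x → Dec (CombVertex x)
      combVertex? x = x ∈? E spine ⊎-dec any? (λ i → x ∈? E (tooth i))

      combEdge? : ∀ j → Dec (CombEdge j)
      combEdge? j = (j ≟ spine) ⊎-dec any? (λ i → j ≟ tooth i)

      combEdge⇒combVertex : ∀ {j x} → CombEdge j → x ∈ E j → CombVertex x
      combEdge⇒combVertex (inj₁ refl)       x∈j = inj₁ x∈j
      combEdge⇒combVertex (inj₂ (i , refl)) x∈j = inj₂ (i , x∈j)

      edgeAtJoint⇒combEdge : ∀ i {j} → j ∈ S → joint i ∈ E j → CombEdge j
      edgeAtJoint⇒combEdge i {j} j∈S joint∈j with j ≟ spine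
      ... | yes j≡spine = inj₁ j≡spine
      ... | no  j≢spine = inj₂ (i , attached⇒tooth i j∈S joint∈j j≢spine)

      combVertex⇒combEdge : ∀ {x} → CombVertex x → x ≢ root → ∀ {j} → j ∈ S → x ∈ E j → CombEdge j
      combVertex⇒combEdge {x} (inj₁ x∈spine) x≢root j∈S x∈j
        with Equivalence.to (∈⇔≡⊎others x) x∈spine
      ... | inj₁ x≡root     = contradiction x≡root x≢root
      ... | inj₂ (i , refl) = edgeAtJoint⇒combEdge i j∈S x∈j
      combVertex⇒combEdge {x} (inj₂ (i , x∈tooth)) x≢root {j} j∈S x∈j with x ≟ joint i
      ... | yes refl    = edgeAtJoint⇒combEdge i j∈S x∈j
      ... | no  x≢joint = inj₂ (i , tooth-pendant i x x∈tooth x≢joint j j∈S x∈j)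

      -- V′ and S′ form the sub-hypertree T′: the comb is deleted except for its endpoint.
      InV′ : Fin n → Set
      InV′ x = x ≡ root ⊎ (x ∈ V × ¬ CombVertex x)

      InS′ : Fin k → Set
      InS′ j = j ∈ S × ¬ CombEdge j

      inV′? : ∀ x → Dec (InV′ x)
      inV′? x = (x ≟ root) ⊎-dec (x ∈? V ×-dec ¬? (combVertex? x))

      inS′? : ∀ j → Dec (InS′ j)
      inS′? j = j ∈? S ×-dec ¬? (combEdge? j)

      V′ : Subset n
      V′ = toSubset inV′?

      S′ : Subset k
      S′ = toSubset inS′?

      V′∩comb⇒root : ∀ {x} → x ∈ V′ → CombVertex x → x ≡ root
      V′∩comb⇒root x∈V′ x∈comb with ∈-toSubset⁻ inV′? x∈V′
      ... | inj₁ x≡root       = x≡root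
      ... | inj₂ (_ , x∉comb) = contradiction x∈comb x∉comb

      root∈V′ : root ∈ V′
      root∈V′ = ∈-toSubset⁺ inV′? (inj₁ refl)

      V′⊆V : V′ ⊆ V
      V′⊆V x∈V′ with ∈-toSubset⁻ inV′? x∈V′
      ... | inj₁ refl      = hypergraph _ spine∈S root∈
      ... | inj₂ (x∈V , _) = x∈V

      S′⊆S : S′ ⊆ S
      S′⊆S = proj₁ ∘ ∈-toSubset⁻ inS′?

      hypergraph′ : IsHypergraph E V′ S′
      hypergraph′ j j∈S′ {x} x∈j with ∈-toSubset⁻ inS′? j∈S′ | x ≟ root
      ... | _            | yes x≡root = ∈-toSubset⁺ inV′? (inj₁ x≡root)
      ... | j∈S , j∉comb | no  x≢root =
        ∈-toSubset⁺ inV′? (inj₂ (hypergraph j j∈S x∈j ,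
                                λ x∈comb → j∉comb (combVertex⇒combEdge x∈comb x≢root j∈S x∈j)))

      reroute : ∀ {w y} → Reach E S w y → y ∈ V′ →
                (w ∈ V′ → Reach E S′ w y) × (CombVertex w → Reach E S′ root y)
      reroute {w} here y∈V′ =
        (λ _ → here) , (λ w∈comb → subst (λ t → Reach E S′ t w) (V′∩comb⇒root y∈V′ w∈comb) here)
      reroute {w} {y} (step {z = z} i i∈S w∈i z∈i rest) y∈V′ with reroute rest y∈V′ | combEdge? i
      ... | _ , fromComb | yes i∈comb =
        (λ w∈V′ → subst (λ t → Reach E S′ t y) (sym (V′∩comb⇒root w∈V′ (combEdge⇒combVertex i∈comb w∈i)))
                        path) ,
        (λ _ → path)
        where
        path : Reach E S′ root y
        path = fromComb (combEdge⇒combVertex i∈comb z∈i)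
      ... | fromV′ , _ | no i∉comb =
        (λ _ → path) ,
        (λ w∈comb → subst (λ t → Reach E S′ t y) (V′∩comb⇒root (hypergraph′ i i∈S′ w∈i) w∈comb) path)
        where
        i∈S′ : i ∈ S′
        i∈S′ = ∈-toSubset⁺ inS′? (i∈S , i∉comb)
        path : Reach E S′ w y
        path = step i i∈S′ w∈i z∈i (fromV′ (hypergraph′ i i∈S′ z∈i))

      hypertree′ : IsHypertree E V′ S′
      hypertree′ = hypergraph′ , connected′ , Acyclic-mono S′⊆S acyclic
        where
        connected′ : Connected E V′ S′
        connected′ x y x∈V′ y∈V′ =
          proj₁ (reroute (proj₁ (proj₂ hypertree) x y (V′⊆V x∈V′) (V′⊆V y∈V′)) y∈V′) x∈V′

      restrict : ∀ {N} → IsPerfectMatching E V S N → IsPerfectMatching E V′ S′ (N ∩ S′)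
      restrict {N} N-matching@(N⊆S , disjoint , covers) =
        proj₂ ∘ x∈p∩q⁻ N S′ ,
        (λ i j i∈ j∈ → disjoint i j (proj₁ (x∈p∩q⁻ N S′ i∈)) (proj₁ (x∈p∩q⁻ N S′ j∈))) ,
        cover′
        where
        cover′ : ∀ x → x ∈ V′ → ∃[ j ] (j ∈ N ∩ S′ × x ∈ E j)
        cover′ x x∈V′ with covers x (V′⊆V x∈V′)
        ... | j , j∈N , x∈j with combEdge? j
        ...   | no  j∉comb          = j , x∈p∩q⁺ (j∈N , ∈-toSubset⁺ inS′? (N⊆S j∈N , j∉comb)) , x∈j
        ...   | yes (inj₁ refl)       = contradiction j∈N (spine∉matching N-matching)
        ...   | yes (inj₂ (i , refl)) with V′∩comb⇒root x∈V′ (inj₂ (i , x∈j))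
        ...     | refl = contradiction (tooth∩spine i x∈j root∈) (joint≢root i ∘ sym)

      V⊆V′∪comb : ∀ {x} → x ∈ V → x ∈ V′ ⊎ CombVertex x
      V⊆V′∪comb {x} x∈V with combVertex? x
      ... | yes x∈comb = inj₂ x∈comb
      ... | no  x∉comb = inj₁ (∈-toSubset⁺ inV′? (inj₂ (x∈V , x∉comb)))

      S′⊂S : S′ ⊂ S
      S′⊂S = S′⊆S , spine , spine∈S , λ spine∈S′ → proj₂ (∈-toSubset⁻ inS′? spine∈S′) (inj₁ refl)

      tooth∈matching : ∀ {N} → IsPerfectMatching E V S N → ∀ i → tooth i ∈ N
      tooth∈matching N-matching i =
        pendant⇒matched hypergraph N-matching (tooth∈S i) (joint∈tooth i) (tooth-pendant i)

      glued : (∀ x → x ∈ V) → (∀ j → j ∈ S) → IsGlued E comb V′ S′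
      glued every-x every-j =
        (λ j → mk⇔ (proj₂ ∘ ∈-toSubset⁻ inS′?) (λ j∉comb → ∈-toSubset⁺ inS′? (every-j j , j∉comb))) ,
        (λ x → V⊆V′∪comb (every-x x)) ,
        (λ x → mk⇔ (λ (x∈V′ , x∈comb) → V′∩comb⇒root x∈V′ x∈comb)
                   (λ { refl → root∈V′ , inj₁ root∈ }))

      A∩S′≡B∩S′⇒A⊆B : ∀ {A B} → IsPerfectMatching E V S A → IsPerfectMatching E V S B →
                      A ∩ S′ ≡ B ∩ S′ → A ⊆ B
      A∩S′≡B∩S′⇒A⊆B {A} {B} A-matching B-matching eq {j} j∈A with combEdge? j
      ... | no  j∉comb            = proj₁ (x∈p∩q⁻ B S′ (subst (j ∈_) eq j∈A∩S′))
        where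
        j∈A∩S′ : j ∈ A ∩ S′
        j∈A∩S′ = x∈p∩q⁺ (j∈A , ∈-toSubset⁺ inS′? (proj₁ A-matching j∈A , j∉comb))
      ... | yes (inj₁ refl)       = contradiction j∈A (spine∉matching A-matching)
      ... | yes (inj₂ (i , refl)) = tooth∈matching B-matching i

  TwoEdges : Subset k → Set
  TwoEdges S = ∃₂ λ e h → e ∈ S × h ∈ S × e ≢ h

  twoEdges? : ∀ S → Dec (TwoEdges S)
  twoEdges? S = any? λ e → any? λ h → e ∈? S ×-dec h ∈? S ×-dec ¬? (e ≟ h)

  ¬twoEdges⇒⊆ : ∀ {V S A B} → IsHypergraph E V S →
                IsPerfectMatching E V S A → IsPerfectMatching E V S B → ¬ TwoEdges S → A ⊆ B
  ¬twoEdges⇒⊆ hypergraph (A⊆S , _) (B⊆S , _ , B-covers) ¬two {j} j∈A with someVertex j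
  ... | x , x∈j with B-covers x (hypergraph j (A⊆S j∈A) x∈j)
  ...   | j′ , j′∈B , x∈j′ with j′ ≟ j
  ...     | yes refl = j′∈B
  ...     | no  j′≢j = contradiction (j′ , j , B⊆S j′∈B , A⊆S j∈A , j′≢j) ¬two

  matching-unique : ∀ r {V S} → ∣ S ∣ < r → IsHypertree E V S → ∀ {A B} →
                    IsPerfectMatching E V S A → IsPerfectMatching E V S B → A ≡ B
  matching-unique (suc r) {S = S} |S|<1+r hypertree {A} {B} A-matching B-matching with twoEdges? S
  ... | no ¬two = ⊆-antisym (¬twoEdges⇒⊆ (proj₁ hypertree) A-matching B-matching ¬two)
                            (¬twoEdges⇒⊆ (proj₁ hypertree) B-matching A-matching ¬two)
  ... | yes (e , h , e∈S , h∈S , e≢h) =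
    ⊆-antisym (A∩S′≡B∩S′⇒A⊆B A-matching B-matching restrictions≡)
              (A∩S′≡B∩S′⇒A⊆B B-matching A-matching (sym restrictions≡))
    where
    open Decomposition hypertree (spineOf hypertree e∈S h∈S e≢h) A-matching
    restrictions≡ : A ∩ S′ ≡ B ∩ S′
    restrictions≡ = matching-unique r (<-≤-trans (p⊂q⇒∣p∣<∣q∣ S′⊂S) (s≤s⁻¹ |S|<1+r))
                                    hypertree′ (restrict A-matching) (restrict B-matching)

lemma5p2 : (m n k : ℕ) (E : Fin k → Subset n) →
    2 ≤ m → IsUniformHypertree E m → HasPerfectMatching E ⊤ ⊤ → 2 ≤ k →
    (∃[ u ] Σ (Comb E m u) λ C → ∃[ V' ] ∃[ S' ]
        (IsGlued E C V' S' × IsHypertree E V' S' × HasPerfectMatching E V' S'))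
    × (∀ M₁ M₂ → IsPerfectMatching E ⊤ ⊤ M₁ → IsPerfectMatching E ⊤ ⊤ M₂ → M₁ ≡ M₂)
lemma5p2 (suc (suc p)) n (suc (suc k)) E (s≤s (s≤s z≤n)) (_ , card , hypertree) (M , matching)
         (s≤s (s≤s z≤n)) =
  (root , comb , V′ , S′ , glued (λ _ → ∈⊤) (λ _ → ∈⊤) , hypertree′ , M ∩ S′ , restrict matching) ,
  λ M₁ M₂ → matching-unique (suc ∣ ⊤ {suc (suc k)} ∣) (n<1+n _) hypertree
  where
  open Uniform E p card
  sp : Spine E ⊤
  sp = spineOf hypertree (∈⊤ {x = zero}) (∈⊤ {x = suc zero}) (λ ())
  open Spine sp
  open Decomposition hypertree sp matching
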